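{- Let $G$ be a group, let $V$ be a finite set equipped with a right action of $G$, written $(v,g)\mapsto vg$, and let $G^V$ be the set of all maps $V\to G$ with the multiplication $$(\phi_2*\phi_1)(v)=\phi_2(v)\,\phi_1\big(v\,\phi_2(v)\big),\qquad \phi_1,\phi_2\in G^V,\ v\in V,$$ whose identity element is the constant map $v\mapsto e$. Then an element $\phi\in G^V$ is invertible with respect to $*$ if and only if the map $V\to V$, $v\mapsto v\,\phi(v)$, is a bijection.
   Context: Here $e$ denotes the identity of $G$. The multiplication $*$ on $G^V$ is associative and the constant map to $e$ is a two-sided identity for it, so $(G^V,*)$ is a monoid; "invertible" means having a two-sided inverse in this monoid. -}

module Defs where

open import Level using (Level; _⊔_; suc)
open import Algebra.Bundles using (Group)
open import Data.Fin using (Fin)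
open import Data.Nat using (ℕ)
open import Data.Product using (Σ; _×_; _,_)
open import Function.Bundles using (_↔_)
open import Function.Definitions using (Bijective)
open import Relation.Binary.PropositionalEquality using (_≡_)

IsFinite : ∀ {a} → Set a → Set a
IsFinite V = Σ ℕ λ n → Fin n ↔ V

module _ {c ℓ : Level} (G : Group c ℓ) where
  open Group G renaming (Carrier to |G|)

  record RightAction {a} (V : Set a) : Set (a ⊔ c ⊔ ℓ) where
    field
      act      : V → |G| → V
      act-cong : ∀ v {g h} → g ≈ h → act v g ≡ act v h
      act-ε    : ∀ v → act v ε ≡ v
      act-∙    : ∀ v g h → act (act v g) h ≡ act v (g ∙ h)

  module _ {a} {V : Set a} (A : RightAction V) where
    open RightAction A

    Maps : Set (a ⊔ c)
    Maps = V → |G|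

    _⊛_ : Maps → Maps → Maps
    (φ₂ ⊛ φ₁) v = φ₂ v ∙ φ₁ (act v (φ₂ v))

    one : Maps
    one _ = ε

    _≈ᴹ_ : Maps → Maps → Set (a ⊔ ℓ)
    φ ≈ᴹ ψ = ∀ v → φ v ≈ ψ v

    Invertible : Maps → Set (a ⊔ c ⊔ ℓ)
    Invertible φ = Σ Maps λ ψ → ((φ ⊛ ψ) ≈ᴹ one) × ((ψ ⊛ φ) ≈ᴹ one)

    twist : Maps → V → V
    twist φ v = act v (φ v)

-- The twist is a monoid homomorphism from (G^V, ⊛) to (V → V, ∘) in reversed order:
-- twist (φ ⊛ ψ) = twist ψ ∘ twist φ, and twist one = id.  So an inverse of φ gives an
-- inverse of twist φ.  Conversely, if τ inverts twist φ then ψ w = φ (τ w)⁻¹ inverts φ,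
-- its own twist being τ.
module Submission where

open import Defs
open import Algebra.Bundles using (Group)
open import Data.Product using (_×_; _,_)
open import Function.Bundles using (Inverse; mk⤖)
open import Function.Definitions
  using (Bijective; StrictlyInverseˡ; StrictlyInverseʳ)
open import Function.Consequences.Propositional
  using (inverseᵇ⇒bijective; strictlyInverseˡ⇒inverseˡ; strictlyInverseʳ⇒inverseʳ)
open import Function.Properties.Bijection using (Bijection⇒Inverse)
open import Relation.Binary.PropositionalEquality
  using (_≡_; sym; trans; cong; module ≡-Reasoning)

module _ {c ℓ a} (G : Group c ℓ) {V : Set a} (A : RightAction G V) where
  open Group G using (_∙_; _⁻¹; ∙-congˡ; inverseˡ; inverseʳ; reflexive)
    renaming (trans to ≈-trans)
  open RightAction A

  twist-⊛ : ∀ φ ψ v → twist G A (_⊛_ G A φ ψ) v ≡ twist G A ψ (twist G A φ v)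
  twist-⊛ φ ψ v = sym (act-∙ v (φ v) (ψ (twist G A φ v)))

  twist-≈one : ∀ {φ} → _≈ᴹ_ G A φ (one G A) → ∀ v → twist G A φ v ≡ v
  twist-≈one φ≈one v = trans (act-cong v (φ≈one v)) (act-ε v)

  twist-inverse : ∀ φ ψ → _≈ᴹ_ G A (_⊛_ G A φ ψ) (one G A) →
                  StrictlyInverseʳ _≡_ (twist G A φ) (twist G A ψ)
  twist-inverse φ ψ φψ≈one v = trans (sym (twist-⊛ φ ψ v)) (twist-≈one φψ≈one v)

  invertible⇒twist-bijective : ∀ {φ} → Invertible G A φ → Bijective _≡_ _≡_ (twist G A φ)
  invertible⇒twist-bijective {φ} (ψ , φψ≈one , ψφ≈one) = inverseᵇ⇒bijective
    ( strictlyInverseˡ⇒inverseˡ (twist G A φ) (twist-inverse ψ φ ψφ≈one)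
    , strictlyInverseʳ⇒inverseʳ (twist G A φ) (twist-inverse φ ψ φψ≈one) )

  twist-inverse⇒invertible : ∀ {φ} (τ : V → V) →
                             StrictlyInverseˡ _≡_ (twist G A φ) τ →
                             StrictlyInverseʳ _≡_ (twist G A φ) τ →
                             Invertible G A φ
  twist-inverse⇒invertible {φ} τ twist∘τ τ∘twist = ψ , φψ≈one , ψφ≈one
    where
    ψ : Maps G A
    ψ w = φ (τ w) ⁻¹

    twist-ψ : ∀ w → twist G A ψ w ≡ τ w
    twist-ψ w = begin
      act w (ψ w)                         ≡⟨ cong (λ u → act u (ψ w)) (sym (twist∘τ w)) ⟩
      act (act (τ w) (φ (τ w))) (ψ w)     ≡⟨ act-∙ (τ w) (φ (τ w)) (ψ w) ⟩
      act (τ w) (φ (τ w) ∙ φ (τ w) ⁻¹)    ≡⟨ twist-≈one (λ _ → inverseʳ (φ (τ w))) (τ w) ⟩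
      τ w                                 ∎
      where open ≡-Reasoning

    φψ≈one : _≈ᴹ_ G A (_⊛_ G A φ ψ) (one G A)
    φψ≈one v = ≈-trans (∙-congˡ (reflexive (cong (λ u → φ u ⁻¹) (τ∘twist v)))) (inverseʳ (φ v))

    ψφ≈one : _≈ᴹ_ G A (_⊛_ G A ψ φ) (one G A)
    ψφ≈one w = ≈-trans (∙-congˡ (reflexive (cong φ (twist-ψ w)))) (inverseˡ (φ (τ w)))

  twist-bijective⇒invertible : ∀ {φ} → Bijective _≡_ _≡_ (twist G A φ) → Invertible G A φ
  twist-bijective⇒invertible bij =
    twist-inverse⇒invertible from strictlyInverseˡ strictlyInverseʳ
    where open Inverse (Bijection⇒Inverse (mk⤖ bij))

lemma2 : ∀ {c ℓ a} (G : Group c ℓ) (V : Set a) → IsFinite V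
    → (A : RightAction G V) (φ : Maps G A)
    → (Invertible G A φ → Bijective _≡_ _≡_ (twist G A φ))
      × (Bijective _≡_ _≡_ (twist G A φ) → Invertible G A φ)
lemma2 G V _ A φ = invertible⇒twist-bijective G A , twist-bijective⇒invertible G A
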